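{- Let $\boldsymbol{\alpha}=(\alpha_i)_{i\in\mathbb{Z}}$ be commuting indeterminates. For every $k\in\mathbb{Z}$, in $\mathbb{Z}[\boldsymbol{\alpha}](\!(z)\!)$, \[ (z^{ -1}|\sigma^{ -1}\boldsymbol{\alpha})^k = (z^{ -1}|\boldsymbol{\alpha})^k + (\alpha_k - \alpha_0)\, (z^{ -1}|\boldsymbol{\alpha})^{k-1}, \qquad \frac{1}{(z^{ -1}|\sigma\boldsymbol{\alpha})^k} = \frac{1}{(z^{ -1}|\boldsymbol{\alpha})^k} + \frac{\alpha_{k+1} - \alpha_1}{(z^{ -1}|\boldsymbol{\alpha})^{k+1}}. \]
   Context: In $\mathbb{Z}[\boldsymbol{\alpha}](\!(z)\!)$ (formal Laurent series in $z$) each $z^{ -1}-a$ with $a\in\{\alpha_i\}$ is invertible with inverse $\sum_{n\ge0}a^nz^{n+1}$. For a sequence $\boldsymbol{\beta}=(\beta_i)_{i\in\mathbb{Z}}$ of such parameters and $k\in\mathbb{Z}$, the shifted power is $(z^{ -1}|\boldsymbol{\beta})^k := \prod_{i=k+1}^{0}(z^{ -1}-\beta_i)^{ -1}\prod_{i=1}^{k}(z^{ -1}-\beta_i)$ (empty products equal $1$). For $m\in\mathbb{Z}$, $\sigma^m\boldsymbol{\alpha}$ denotes the shifted sequence whose $i$-th entry is $\alpha_{i+m}$ (so $\sigma\boldsymbol{\alpha}=(\alpha_{i+1})_i$ and $\sigma^{ -1}\boldsymbol{\alpha}=(\alpha_{i-1})_i$). -}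

module Defs where

open import Level using (_⊔_)
open import Algebra.Bundles using (CommutativeRing)
open import Data.Nat using (ℕ; zero; suc; _∸_)
open import Data.Integer using (ℤ; +_; -[1+_]; _⊓_) renaming (_+_ to _+ℤ_; _-_ to _-ℤ_)
open import Data.Product using (_×_)

-- Formal Laurent series  Σ_{n ≥ 0} coeff n · z^(ord + n)  over a commutative ring R,
-- with coefficientwise equality.
module Laurent {c ℓ} (R : CommutativeRing c ℓ) where
  open CommutativeRing R

  _−_ : Carrier → Carrier → Carrier
  x − y = x + (- y)

  record LSeries : Set c where
    constructor mkL
    field
      ord   : ℤ
      coeff : ℕ → Carrier
  open LSeries public

  coeffAt : LSeries → ℤ → Carrier
  coeffAt x j with j -ℤ ord x
  ... | + n      = coeff x n
  ... | -[1+ _ ] = 0#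

  infix 4 _≈L_
  _≈L_ : LSeries → LSeries → Set ℓ
  x ≈L y = ∀ j → coeffAt x j ≈ coeffAt y j

  sumBelow : (ℕ → Carrier) → ℕ → Carrier
  sumBelow h zero    = 0#
  sumBelow h (suc n) = sumBelow h n + h n

  pow : Carrier → ℕ → Carrier
  pow a zero    = 1#
  pow a (suc n) = pow a n * a

  oneL : LSeries
  oneL = mkL (+ 0) (λ { zero → 1# ; (suc _) → 0# })

  infixl 6 _+L_
  _+L_ : LSeries → LSeries → LSeries
  x +L y = mkL o (λ n → coeffAt x (o +ℤ + n) + coeffAt y (o +ℤ + n))
    where o = ord x ⊓ ord y

  infixl 7 _*L_
  _*L_ : LSeries → LSeries → LSeries
  x *L y = mkL (ord x +ℤ ord y)
               (λ n → sumBelow (λ i → coeff x i * coeff y (n ∸ i)) (suc n))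

  infixr 7 _·L_
  _·L_ : Carrier → LSeries → LSeries
  a ·L x = mkL (ord x) (λ n → a * coeff x n)

  zinvMinus : Carrier → LSeries
  zinvMinus a = mkL -[1+ 0 ] (λ { zero → 1# ; (suc zero) → - a ; (suc (suc _)) → 0# })

  -- (z⁻¹ - a)⁻¹ = Σ_{n ≥ 0} a^n z^(n+1)
  zinvMinusInv : Carrier → LSeries
  zinvMinusInv a = mkL (+ 1) (λ n → pow a n)

  negProd : (ℤ → Carrier) → ℕ → LSeries
  negProd β zero    = zinvMinusInv (β (+ 0))
  negProd β (suc n) = negProd β n *L zinvMinusInv (β -[1+ n ])

  shiftedPow : (ℤ → Carrier) → ℤ → LSeries
  shiftedPow β (+ zero)    = oneL
  shiftedPow β (+ (suc n)) = shiftedPow β (+ n) *L zinvMinus (β (+ suc n))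
  shiftedPow β -[1+ n ]    = negProd β n

  σ^ : ℤ → (ℤ → Carrier) → (ℤ → Carrier)
  σ^ m β i = β (i +ℤ m)

{-# OPTIONS --safe #-}
module Submission where

open import Defs
open import Algebra.Bundles using (CommutativeRing)
open import Data.Integer using (ℤ; +_; -[1+_]) renaming (_+_ to _+ℤ_; _-_ to _-ℤ_)
open import Data.Product using (_×_)

open import Data.Empty using (⊥-elim)
open import Data.Integer using (_⊓_; ∣_∣; _≤?_; +≤+; +<+) renaming (_≤_ to _≤ℤ_; _<_ to _<ℤ_)
import Data.Integer.Properties as ℤ
open import Data.Integer.Tactic.RingSolver using (solve-∀)
open import Data.Nat using (ℕ; zero; suc; _∸_; _<_; z≤n; s≤s)
import Data.Nat.Properties as ℕ
open import Data.Product using (_,_)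
open import Function using (_∘_)
open import Relation.Binary.Bundles using (Setoid)
open import Relation.Binary.PropositionalEquality as ≡ using (_≡_)
import Relation.Binary.Reasoning.Setoid as SetoidReasoning
open import Relation.Nullary using (yes; no)

-- Both identities come from two ways of splitting one linear factor off a shifted power,
-- valid for every k ∈ ℤ:
--   (z⁻¹|β)^(k+1) = (z⁻¹|β)^k (z⁻¹ − β_(k+1)) = (z⁻¹ − β_1) (z⁻¹|σβ)^k,
-- together with z⁻¹ − a = (z⁻¹ − b) + (b − a).  For β = σ⁻¹α the second splitting reads
-- (z⁻¹|σ⁻¹α)^k = (z⁻¹ − α_0) (z⁻¹|α)^(k−1); writing z⁻¹ − α_0 = (z⁻¹ − α_k) + (α_k − α_0) and
-- absorbing z⁻¹ − α_k by the first splitting gives the first identity.  For the second, if W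
-- inverts (z⁻¹|α)^(k+1), the two splittings show that W (z⁻¹ − α_1) inverts (z⁻¹|σα)^k and
-- W (z⁻¹ − α_(k+1)) inverts (z⁻¹|α)^k, and these differ by (α_(k+1) − α_1) W.

i+[j-i]≡j : ∀ i j → i +ℤ (j -ℤ i) ≡ j
i+[j-i]≡j = solve-∀

[i+j]-i≡j : ∀ i j → (i +ℤ j) -ℤ i ≡ j
[i+j]-i≡j = solve-∀

i≤j⇒i+∣j-i∣≡j : ∀ {i j} → i ≤ℤ j → i +ℤ + ∣ j -ℤ i ∣ ≡ j
i≤j⇒i+∣j-i∣≡j {i} {j} i≤j =
  ≡.trans (≡.cong (i +ℤ_) (ℤ.0≤i⇒+∣i∣≡i (ℤ.i≤j⇒0≤j-i i≤j))) (i+[j-i]≡j i j)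

i<i+1+n : ∀ i n → i <ℤ i +ℤ + suc n
i<i+1+n i n = ≡.subst (_<ℤ i +ℤ + suc n) (ℤ.+-identityʳ i) (ℤ.+-monoʳ-< i (+<+ (s≤s z≤n)))

[i+j]+1≡[i+1]+j : ∀ i j → (i +ℤ j) +ℤ + 1 ≡ (i +ℤ + 1) +ℤ j
[i+j]+1≡[i+1]+j = solve-∀

[i+1]-1≡i : ∀ i → (i +ℤ + 1) +ℤ -[1+ 0 ] ≡ i
[i+1]-1≡i = solve-∀

[i-1]+1≡i : ∀ i → (i -ℤ + 1) +ℤ + 1 ≡ i
[i-1]+1≡i = solve-∀

+n+1≡+[1+n] : ∀ n → + n +ℤ + 1 ≡ + suc n
+n+1≡+[1+n] n = ≡.cong +_ (ℕ.+-comm n 1)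

module LaurentProperties {c ℓ} (R : CommutativeRing c ℓ) where
  open CommutativeRing R hiding (zero)
  open Laurent R
  open import Algebra.Properties.Ring ring using (-‿distribˡ-*)
  open import Algebra.Properties.CommutativeSemigroup +-commutativeSemigroup using (x∙yz≈y∙xz)

  sumBelow-cong : ∀ {f g} n → (∀ i → i < n → f i ≈ g i) → sumBelow f n ≈ sumBelow g n
  sumBelow-cong zero    f≈g = refl
  sumBelow-cong (suc n) f≈g =
    +-cong (sumBelow-cong n (λ i i<n → f≈g i (ℕ.m<n⇒m<1+n i<n))) (f≈g n ℕ.≤-refl)

  sumBelow-zero : ∀ {f} n → (∀ i → f i ≈ 0#) → sumBelow f n ≈ 0#
  sumBelow-zero zero    f≈0 = refl
  sumBelow-zero (suc n) f≈0 = trans (+-cong (sumBelow-zero n f≈0) (f≈0 n)) (+-identityˡ 0#)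

  sumBelow-+ : ∀ f g n → sumBelow (λ i → f i + g i) n ≈ sumBelow f n + sumBelow g n
  sumBelow-+ f g zero    = sym (+-identityˡ 0#)
  sumBelow-+ f g (suc n) = begin
    sumBelow (λ i → f i + g i) n + (f n + g n)        ≈⟨ +-congʳ (sumBelow-+ f g n) ⟩
    (sumBelow f n + sumBelow g n) + (f n + g n)       ≈⟨ +-assoc _ _ _ ⟩
    sumBelow f n + (sumBelow g n + (f n + g n))       ≈⟨ +-congˡ (x∙yz≈y∙xz _ _ _) ⟩
    sumBelow f n + (f n + (sumBelow g n + g n))       ≈⟨ +-assoc _ _ _ ⟨
    (sumBelow f n + f n) + (sumBelow g n + g n)       ∎
    where open SetoidReasoning setoid

  sumBelow-*ˡ : ∀ a f n → sumBelow (λ i → a * f i) n ≈ a * sumBelow f n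
  sumBelow-*ˡ a f zero    = sym (zeroʳ a)
  sumBelow-*ˡ a f (suc n) = trans (+-congʳ (sumBelow-*ˡ a f n)) (sym (distribˡ a _ _))

  sumBelow-head : ∀ f n → sumBelow f (suc n) ≈ f 0 + sumBelow (f ∘ suc) n
  sumBelow-head f zero    = trans (+-identityˡ (f 0)) (sym (+-identityʳ (f 0)))
  sumBelow-head f (suc n) = trans (+-congʳ (sumBelow-head f n)) (+-assoc _ _ _)

  sumBelow-reverse : ∀ f n → sumBelow f (suc n) ≈ sumBelow (λ i → f (n ∸ i)) (suc n)
  sumBelow-reverse f zero    = refl
  sumBelow-reverse f (suc n) = begin
    sumBelow f (suc n) + f (suc n)
      ≈⟨ +-comm _ _ ⟩
    f (suc n) + sumBelow f (suc n)
      ≈⟨ +-congˡ (sumBelow-reverse f n) ⟩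
    f (suc n) + sumBelow (λ i → f (n ∸ i)) (suc n)
      ≈⟨ sumBelow-head (λ i → f (suc n ∸ i)) (suc n) ⟨
    sumBelow (λ i → f (suc n ∸ i)) (suc (suc n))
      ∎
    where open SetoidReasoning setoid

  conv : (ℕ → Carrier) → (ℕ → Carrier) → ℕ → Carrier
  conv f g n = sumBelow (λ i → f i * g (n ∸ i)) (suc n)

  conv-cong : ∀ {f f′ g g′} → (∀ i → f i ≈ f′ i) → (∀ i → g i ≈ g′ i) →
              ∀ n → conv f g n ≈ conv f′ g′ n
  conv-cong f≈f′ g≈g′ n = sumBelow-cong (suc n) (λ i _ → *-cong (f≈f′ i) (g≈g′ (n ∸ i)))

  conv-zero : ∀ f g → conv f g 0 ≈ f 0 * g 0
  conv-zero f g = +-identityˡ _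

  conv-suc : ∀ f g n → conv f g (suc n) ≈ f 0 * g (suc n) + conv (f ∘ suc) g n
  conv-suc f g n = sumBelow-head (λ i → f i * g (suc n ∸ i)) (suc n)

  conv-zeroˡ : ∀ {f} → (∀ i → f i ≈ 0#) → ∀ g n → conv f g n ≈ 0#
  conv-zeroˡ f≈0 g n = sumBelow-zero (suc n) (λ i → trans (*-congʳ (f≈0 i)) (zeroˡ _))

  conv-comm : ∀ f g n → conv f g n ≈ conv g f n
  conv-comm f g n = trans (sumBelow-reverse (λ i → f i * g (n ∸ i)) n)
    (sumBelow-cong (suc n) (λ i i≤n →
      trans (*-comm _ _) (*-congʳ (reflexive (≡.cong g (ℕ.m∸[m∸n]≡n (ℕ.m<1+n⇒m≤n i≤n)))))))

  conv-identityˡ : ∀ g n → conv (coeff oneL) g n ≈ g n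
  conv-identityˡ g zero    = trans (conv-zero (coeff oneL) g) (*-identityˡ (g 0))
  conv-identityˡ g (suc n) = begin
    conv (coeff oneL) g (suc n)             ≈⟨ conv-suc (coeff oneL) g n ⟩
    1# * g (suc n) + conv (λ _ → 0#) g n    ≈⟨ +-cong (*-identityˡ _) (conv-zeroˡ (λ _ → refl) g n) ⟩
    g (suc n) + 0#                          ≈⟨ +-identityʳ _ ⟩
    g (suc n)                               ∎
    where open SetoidReasoning setoid

  conv-distribʳ : ∀ f f′ g n → conv (λ i → f i + f′ i) g n ≈ conv f g n + conv f′ g n
  conv-distribʳ f f′ g n =
    trans (sumBelow-cong (suc n) (λ i _ → distribʳ _ _ _)) (sumBelow-+ _ _ (suc n))

  conv-*ˡ : ∀ a f g n → conv (λ i → a * f i) g n ≈ a * conv f g n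
  conv-*ˡ a f g n = trans (sumBelow-cong (suc n) (λ i _ → *-assoc _ _ _)) (sumBelow-*ˡ a _ (suc n))

  conv-assoc : ∀ f g h n → conv (conv f g) h n ≈ conv f (conv g h) n
  conv-assoc f g h zero = begin
    conv (conv f g) h 0          ≈⟨ trans (conv-zero (conv f g) h) (*-congʳ (conv-zero f g)) ⟩
    (f 0 * g 0) * h 0            ≈⟨ *-assoc _ _ _ ⟩
    f 0 * (g 0 * h 0)            ≈⟨ trans (conv-zero f (conv g h)) (*-congˡ (conv-zero g h)) ⟨
    conv f (conv g h) 0          ∎
    where open SetoidReasoning setoid
  conv-assoc f g h (suc n) = begin
    conv (conv f g) h (suc n)
      ≈⟨ conv-suc (conv f g) h n ⟩
    conv f g 0 * h (suc n) + conv (conv f g ∘ suc) h n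
      ≈⟨ +-cong (*-congʳ (conv-zero f g)) (conv-cong {g = h} (conv-suc f g) (λ _ → refl) n) ⟩
    f 0 * g 0 * h (suc n) + conv (λ i → f 0 * g (suc i) + conv (f ∘ suc) g i) h n
      ≈⟨ +-congˡ (conv-distribʳ _ _ h n) ⟩
    f 0 * g 0 * h (suc n) + (conv (λ i → f 0 * g (suc i)) h n + conv (conv (f ∘ suc) g) h n)
      ≈⟨ +-congˡ (+-cong (conv-*ˡ (f 0) (g ∘ suc) h n) (conv-assoc (f ∘ suc) g h n)) ⟩
    f 0 * g 0 * h (suc n) + (f 0 * conv (g ∘ suc) h n + conv (f ∘ suc) (conv g h) n)
      ≈⟨ +-assoc _ _ _ ⟨
    (f 0 * g 0 * h (suc n) + f 0 * conv (g ∘ suc) h n) + conv (f ∘ suc) (conv g h) n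
      ≈⟨ +-congʳ (trans (+-congʳ (*-assoc _ _ _)) (sym (distribˡ _ _ _))) ⟩
    f 0 * (g 0 * h (suc n) + conv (g ∘ suc) h n) + conv (f ∘ suc) (conv g h) n
      ≈⟨ +-congʳ (*-congˡ (conv-suc g h n)) ⟨
    f 0 * conv g h (suc n) + conv (f ∘ suc) (conv g h) n
      ≈⟨ conv-suc f (conv g h) n ⟨
    conv f (conv g h) (suc n)
      ∎
    where open SetoidReasoning setoid

  pad : (ℕ → Carrier) → ℕ → Carrier
  pad f zero    = 0#
  pad f (suc n) = f n

  conv-padˡ : ∀ f g n → conv (pad f) g n ≈ pad (conv f g) n
  conv-padˡ f g zero    = trans (conv-zero (pad f) g) (zeroˡ _)
  conv-padˡ f g (suc n) = trans (conv-suc (pad f) g n) (trans (+-congʳ (zeroˡ _)) (+-identityˡ _))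

  coeffAt-ord+ : ∀ x n → coeffAt x (ord x +ℤ + n) ≡ coeff x n
  coeffAt-ord+ x n rewrite [i+j]-i≡j (ord x) (+ n) = ≡.refl

  coeffAt-<ord : ∀ x {j} → j <ℤ ord x → coeffAt x j ≡ 0#
  coeffAt-<ord x {j} j<o with j -ℤ ord x in eq
  ... | + n      = ⊥-elim (ℤ.<⇒≱ j<o (ℤ.0≤i-j⇒j≤i (≡.subst (+ 0 ≤ℤ_) (≡.sym eq) (+≤+ z≤n))))
  ... | -[1+ _ ] = ≡.refl

  data Position (m : ℤ) : ℤ → Set where
    at    : ∀ n → Position m (m +ℤ + n)
    below : ∀ {j} → j <ℤ m → Position m j

  position : ∀ m j → Position m j
  position m j with m ≤? j
  ... | yes m≤j = ≡.subst (Position m) (i≤j⇒i+∣j-i∣≡j m≤j) (at ∣ j -ℤ m ∣)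
  ... | no  m≰j = below (ℤ.≰⇒> m≰j)

  ≈L-refl : ∀ {x} → x ≈L x
  ≈L-refl j = refl

  ≈L-sym : ∀ {x y} → x ≈L y → y ≈L x
  ≈L-sym x≈y j = sym (x≈y j)

  ≈L-trans : ∀ {x y z} → x ≈L y → y ≈L z → x ≈L z
  ≈L-trans x≈y y≈z j = trans (x≈y j) (y≈z j)

  ≈L-setoid : Setoid c ℓ
  ≈L-setoid = record
    { Carrier       = LSeries
    ; _≈_           = _≈L_
    ; isEquivalence = record { refl = ≈L-refl ; sym = ≈L-sym ; trans = ≈L-trans }
    }

  ≈L-from : ∀ {x y} m → m ≤ℤ ord x → m ≤ℤ ord y →
            (∀ n → coeffAt x (m +ℤ + n) ≈ coeffAt y (m +ℤ + n)) → x ≈L y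
  ≈L-from {x} {y} m m≤x m≤y agree j with position m j
  ... | at n        = agree n
  ... | below j<m   = reflexive (≡.trans (coeffAt-<ord x (ℤ.<-≤-trans j<m m≤x))
                                         (≡.sym (coeffAt-<ord y (ℤ.<-≤-trans j<m m≤y))))

  mkL-cong : ∀ {o o′ f f′} → o ≡ o′ → (∀ n → f n ≈ f′ n) → mkL o f ≈L mkL o′ f′
  mkL-cong {o} ≡.refl f≈f′ j with j -ℤ o
  ... | + n      = f≈f′ n
  ... | -[1+ _ ] = refl

  coeffAt-+L : ∀ x y j → coeffAt (x +L y) j ≈ coeffAt x j + coeffAt y j
  coeffAt-+L x y j with position (ord x ⊓ ord y) j
  ... | at n      = reflexive (coeffAt-ord+ (x +L y) n)
  ... | below j<m = begin
    coeffAt (x +L y) j          ≡⟨ coeffAt-<ord (x +L y) j<m ⟩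
    0#                          ≈⟨ +-identityˡ 0# ⟨
    0# + 0#                     ≡⟨ ≡.cong₂ _+_ (vanishes x (ℤ.i⊓j≤i _ _)) (vanishes y (ℤ.i⊓j≤j _ _)) ⟨
    coeffAt x j + coeffAt y j   ∎
    where
    open SetoidReasoning setoid
    vanishes : ∀ z → ord x ⊓ ord y ≤ℤ ord z → coeffAt z j ≡ 0#
    vanishes z m≤z = coeffAt-<ord z (ℤ.<-≤-trans j<m m≤z)

  coeffAt-·L : ∀ a x j → coeffAt (a ·L x) j ≈ a * coeffAt x j
  coeffAt-·L a x j with j -ℤ ord x
  ... | + n      = refl
  ... | -[1+ _ ] = sym (zeroʳ a)

  +L-cong : ∀ {x x′ y y′} → x ≈L x′ → y ≈L y′ → x +L y ≈L x′ +L y′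
  +L-cong {x} {x′} {y} {y′} x≈x′ y≈y′ j =
    trans (coeffAt-+L x y j) (trans (+-cong (x≈x′ j) (y≈y′ j)) (sym (coeffAt-+L x′ y′ j)))

  ·L-congˡ : ∀ a {x x′} → x ≈L x′ → a ·L x ≈L a ·L x′
  ·L-congˡ a {x} {x′} x≈x′ j =
    trans (coeffAt-·L a x j) (trans (*-congˡ (x≈x′ j)) (sym (coeffAt-·L a x′ j)))

  mkL-+L : ∀ o f g → mkL o (λ n → f n + g n) ≈L mkL o f +L mkL o g
  mkL-+L o f g j = trans (pointwise j) (sym (coeffAt-+L (mkL o f) (mkL o g) j))
    where
    pointwise : ∀ j → coeffAt (mkL o (λ n → f n + g n)) j ≈ coeffAt (mkL o f) j + coeffAt (mkL o g) j
    pointwise j with j -ℤ o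
    ... | + n      = refl
    ... | -[1+ _ ] = sym (+-identityˡ 0#)

  -- _≈L_ only sees coefficients while _*L_ computes on representations; re-expanding x from a
  -- lower order m only prepends zeros and does not change x *L y (*L-rebaseˡ), which is how
  -- _*L_ is shown to respect _≈L_.
  rebase : LSeries → ℤ → LSeries
  rebase x m = mkL m (λ n → coeffAt x (m +ℤ + n))

  rebase-≈L : ∀ {x m} → m ≤ℤ ord x → rebase x m ≈L x
  rebase-≈L {x} {m} m≤x = ≈L-from m ℤ.≤-refl m≤x (λ n → reflexive (coeffAt-ord+ (rebase x m) n))

  rebase-pad : ∀ x {m} → m <ℤ ord x → ∀ n → coeff (rebase x m) n ≡ pad (coeff (rebase x (m +ℤ + 1))) n
  rebase-pad x {m} m<x zero    = coeffAt-<ord x (≡.subst (_<ℤ ord x) (≡.sym (ℤ.+-identityʳ m)) m<x)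
  rebase-pad x {m} m<x (suc n) = ≡.cong (coeffAt x) (≡.sym (ℤ.+-assoc m (+ 1) (+ n)))

  mkL-pad : ∀ o h → mkL o (pad h) ≈L mkL (o +ℤ + 1) h
  mkL-pad o h = ≈L-trans (mkL-cong ≡.refl pointwise) (rebase-≈L (ℤ.<⇒≤ o<o+1))
    where
    y : LSeries
    y = mkL (o +ℤ + 1) h
    o<o+1 : o <ℤ o +ℤ + 1
    o<o+1 = i<i+1+n o 0
    pointwise : ∀ n → pad h n ≈ coeff (rebase y o) n
    pointwise zero    = reflexive (≡.sym (rebase-pad y o<o+1 zero))
    pointwise (suc n) = reflexive (≡.sym (≡.trans (rebase-pad y o<o+1 (suc n)) (coeffAt-ord+ y n)))

  mkL-*L-congˡ : ∀ o {f f′} → (∀ n → f n ≈ f′ n) → ∀ y → mkL o f *L y ≈L mkL o f′ *L y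
  mkL-*L-congˡ o f≈f′ y = mkL-cong ≡.refl (conv-cong {g = coeff y} f≈f′ (λ _ → refl))

  *L-padˡ : ∀ o h y → mkL o (pad h) *L y ≈L mkL (o +ℤ + 1) h *L y
  *L-padˡ o h y = ≈L-trans (mkL-cong ≡.refl (conv-padˡ h (coeff y)))
    (≈L-trans (mkL-pad (o +ℤ ord y) (conv h (coeff y)))
              (mkL-cong ([i+j]+1≡[i+1]+j o (ord y)) (λ _ → refl)))

  *L-rebaseˡ : ∀ {x m} y → m ≤ℤ ord x → rebase x m *L y ≈L x *L y
  *L-rebaseˡ {x} {m} y m≤x = lower ∣ ord x -ℤ m ∣ m (≡.sym (i≤j⇒i+∣j-i∣≡j m≤x))
    where
    open SetoidReasoning ≈L-setoid
    lower : ∀ d b → ord x ≡ b +ℤ + d → rebase x b *L y ≈L x *L y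
    lower zero    b x≡b+0 = ≡.subst (λ b → rebase x b *L y ≈L x *L y) (≡.trans x≡b+0 (ℤ.+-identityʳ b))
                                    (mkL-*L-congˡ (ord x) (reflexive ∘ coeffAt-ord+ x) y)
    lower (suc d) b x≡b+1+d = begin
      rebase x b *L y                 ≈⟨ mkL-*L-congˡ b (reflexive ∘ rebase-pad x b<x) y ⟩
      mkL b (pad tail) *L y           ≈⟨ *L-padˡ b tail y ⟩
      rebase x (b +ℤ + 1) *L y        ≈⟨ lower d (b +ℤ + 1) x≡[b+1]+d ⟩
      x *L y                          ∎
      where
      tail : ℕ → Carrier
      tail = coeff (rebase x (b +ℤ + 1))
      b<x : b <ℤ ord x
      b<x = ≡.subst (b <ℤ_) (≡.sym x≡b+1+d) (i<i+1+n b d)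
      x≡[b+1]+d : ord x ≡ (b +ℤ + 1) +ℤ + d
      x≡[b+1]+d = ≡.trans x≡b+1+d (≡.sym (ℤ.+-assoc b (+ 1) (+ d)))

  *L-congˡ : ∀ {x x′} y → x ≈L x′ → x *L y ≈L x′ *L y
  *L-congˡ {x} {x′} y x≈x′ = ≈L-trans (≈L-sym (*L-rebaseˡ y (ℤ.i⊓j≤i (ord x) (ord x′))))
    (≈L-trans (mkL-*L-congˡ m (λ n → x≈x′ (m +ℤ + n)) y) (*L-rebaseˡ y (ℤ.i⊓j≤j (ord x) (ord x′))))
    where
    m : ℤ
    m = ord x ⊓ ord x′

  *L-comm : ∀ x y → x *L y ≈L y *L x
  *L-comm x y = mkL-cong (ℤ.+-comm (ord x) (ord y)) (conv-comm (coeff x) (coeff y))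

  *L-congʳ : ∀ x {y y′} → y ≈L y′ → x *L y ≈L x *L y′
  *L-congʳ x {y} {y′} y≈y′ = ≈L-trans (*L-comm x y) (≈L-trans (*L-congˡ x y≈y′) (*L-comm y′ x))

  *L-assoc : ∀ x y z → (x *L y) *L z ≈L x *L (y *L z)
  *L-assoc x y z = mkL-cong (ℤ.+-assoc (ord x) (ord y) (ord z)) (conv-assoc (coeff x) (coeff y) (coeff z))

  *L-identityˡ : ∀ x → oneL *L x ≈L x
  *L-identityˡ x = mkL-cong (ℤ.+-identityˡ (ord x)) (conv-identityˡ (coeff x))

  *L-identityʳ : ∀ x → x *L oneL ≈L x
  *L-identityʳ x = ≈L-trans (*L-comm x oneL) (*L-identityˡ x)

  *L-·Lˡ : ∀ a x y → (a ·L x) *L y ≈L a ·L (x *L y)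
  *L-·Lˡ a x y = mkL-cong ≡.refl (conv-*ˡ a (coeff x) (coeff y))

  *L-distribʳ : ∀ x y w → (x +L y) *L w ≈L x *L w +L y *L w
  *L-distribʳ x y w =
    ≈L-trans (mkL-cong ≡.refl (conv-distribʳ (coeff (rebase x m)) (coeff (rebase y m)) (coeff w)))
    (≈L-trans (mkL-+L (m +ℤ ord w) _ _)
              (+L-cong (*L-rebaseˡ w (ℤ.i⊓j≤i (ord x) (ord y))) (*L-rebaseˡ w (ℤ.i⊓j≤j (ord x) (ord y)))))
    where
    m : ℤ
    m = ord x ⊓ ord y

  *L-cancelʳ : ∀ x y z → y *L z ≈L oneL → (x *L y) *L z ≈L x
  *L-cancelʳ x y z yz≈1 =
    ≈L-trans (*L-assoc x y z) (≈L-trans (*L-congʳ x yz≈1) (*L-identityʳ x))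

  *L-cancelˡ : ∀ x y z → x *L y ≈L oneL → x *L (y *L z) ≈L z
  *L-cancelˡ x y z xy≈1 =
    ≈L-trans (≈L-sym (*L-assoc x y z)) (≈L-trans (*L-congˡ z xy≈1) (*L-identityˡ z))

  inverse-unique : ∀ x u s → x *L s ≈L oneL → u *L s ≈L oneL → x ≈L u
  inverse-unique x u s xs≈1 us≈1 = begin
    x                  ≈⟨ *L-identityʳ x ⟨
    x *L oneL          ≈⟨ *L-congʳ x us≈1 ⟨
    x *L (u *L s)      ≈⟨ *L-assoc x u s ⟨
    (x *L u) *L s      ≈⟨ *L-congˡ s (*L-comm x u) ⟩
    (u *L x) *L s      ≈⟨ *L-cancelʳ u x s xs≈1 ⟩
    u                  ∎
    where open SetoidReasoning ≈L-setoid

  zinvMinus-inverseʳ : ∀ a → zinvMinus a *L zinvMinusInv a ≈L oneL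
  zinvMinus-inverseʳ a = mkL-cong ≡.refl coeffs
    where
    z : ℕ → Carrier
    z = coeff (zinvMinus a)
    tail : ∀ n → conv (z ∘ suc) (pow a) n ≈ - a * pow a n
    tail zero    = conv-zero (z ∘ suc) (pow a)
    tail (suc n) = trans (conv-suc (z ∘ suc) (pow a) n)
      (trans (+-congˡ (conv-zeroˡ (λ _ → refl) (pow a) n)) (+-identityʳ _))
    coeffs : ∀ n → conv z (pow a) n ≈ coeff oneL n
    coeffs zero    = trans (conv-zero z (pow a)) (*-identityˡ 1#)
    coeffs (suc n) = begin
      conv z (pow a) (suc n)
        ≈⟨ conv-suc z (pow a) n ⟩
      1# * (pow a n * a) + conv (z ∘ suc) (pow a) n
        ≈⟨ +-cong (trans (*-identityˡ _) (*-comm _ a)) (tail n) ⟩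
      a * pow a n + - a * pow a n
        ≈⟨ +-congˡ (-‿distribˡ-* a (pow a n)) ⟨
      a * pow a n + - (a * pow a n)
        ≈⟨ -‿inverseʳ _ ⟩
      0#
        ∎
      where open SetoidReasoning setoid

  zinvMinus-inverseˡ : ∀ a → zinvMinusInv a *L zinvMinus a ≈L oneL
  zinvMinus-inverseˡ a = ≈L-trans (*L-comm (zinvMinusInv a) (zinvMinus a)) (zinvMinus-inverseʳ a)

  zinvMinus-≈ : ∀ a b → zinvMinus a ≈L zinvMinus b +L (b − a) ·L oneL
  zinvMinus-≈ a b = mkL-cong ≡.refl coeffs
    where
    coeffs : ∀ n → coeff (zinvMinus a) n ≈ coeff (zinvMinus b +L (b − a) ·L oneL) n
    coeffs zero          = sym (+-identityʳ 1#)
    coeffs (suc zero)    = begin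
      - a                          ≈⟨ +-identityˡ (- a) ⟨
      0# + - a                     ≈⟨ +-congʳ (-‿inverseˡ b) ⟨
      (- b + b) + - a              ≈⟨ +-assoc (- b) b (- a) ⟩
      - b + (b − a)                ≈⟨ +-congˡ (*-identityʳ (b − a)) ⟨
      - b + (b − a) * 1#           ∎
      where open SetoidReasoning setoid
    coeffs (suc (suc n)) =
      sym (trans (+-cong (reflexive (coeffAt-ord+ (zinvMinus b) (suc (suc n)))) (zeroʳ _)) (+-identityʳ 0#))

  zinvMinus-*L : ∀ a b x → zinvMinus a *L x ≈L zinvMinus b *L x +L (b − a) ·L x
  zinvMinus-*L a b x = ≈L-trans (*L-congˡ x (zinvMinus-≈ a b))
    (≈L-trans (*L-distribʳ (zinvMinus b) ((b − a) ·L oneL) x)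
              (+L-cong ≈L-refl (≈L-trans (*L-·Lˡ (b − a) oneL x) (·L-congˡ (b − a) (*L-identityˡ x)))))

module ShiftedPowers {c ℓ} (R : CommutativeRing c ℓ) where
  open CommutativeRing R using (Carrier)
  open Laurent R
  open LaurentProperties R
  open SetoidReasoning ≈L-setoid

  negProd-cong : ∀ {β β′} → (∀ i → β i ≡ β′ i) → ∀ n → negProd β n ≡ negProd β′ n
  negProd-cong β≡β′ zero    = ≡.cong zinvMinusInv (β≡β′ (+ 0))
  negProd-cong β≡β′ (suc n) = ≡.cong₂ _*L_ (negProd-cong β≡β′ n) (≡.cong zinvMinusInv (β≡β′ -[1+ n ]))

  shiftedPow-cong : ∀ {β β′} → (∀ i → β i ≡ β′ i) → ∀ k → shiftedPow β k ≡ shiftedPow β′ k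
  shiftedPow-cong β≡β′ (+ zero)    = ≡.refl
  shiftedPow-cong β≡β′ (+ (suc n)) =
    ≡.cong₂ _*L_ (shiftedPow-cong β≡β′ (+ n)) (≡.cong zinvMinus (β≡β′ (+ suc n)))
  shiftedPow-cong β≡β′ -[1+ n ]    = negProd-cong β≡β′ n

  shiftedPow-sucʳ : ∀ β k → shiftedPow β (k +ℤ + 1) ≈L shiftedPow β k *L zinvMinus (β (k +ℤ + 1))
  shiftedPow-sucʳ β (+ n) rewrite +n+1≡+[1+n] n = ≈L-refl
  shiftedPow-sucʳ β -[1+ zero ]  = ≈L-sym (zinvMinus-inverseˡ (β (+ 0)))
  shiftedPow-sucʳ β -[1+ suc n ] =
    ≈L-sym (*L-cancelʳ (negProd β n) (zinvMinusInv (β -[1+ n ])) (zinvMinus (β -[1+ n ]))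
                       (zinvMinus-inverseˡ (β -[1+ n ])))

  negProd-σ : ∀ β n → zinvMinus (β (+ 1)) *L negProd (σ^ (+ 1) β) (suc n) ≈L negProd β n
  negProd-σ β zero    =
    *L-cancelˡ (zinvMinus (β (+ 1))) (zinvMinusInv (β (+ 1))) (zinvMinusInv (β (+ 0)))
               (zinvMinus-inverseʳ (β (+ 1)))
  negProd-σ β (suc n) = begin
    z *L (negProd (σ^ (+ 1) β) (suc n) *L zinvMinusInv (β -[1+ n ]))
      ≈⟨ *L-assoc z (negProd (σ^ (+ 1) β) (suc n)) (zinvMinusInv (β -[1+ n ])) ⟨
    (z *L negProd (σ^ (+ 1) β) (suc n)) *L zinvMinusInv (β -[1+ n ])
      ≈⟨ *L-congˡ (zinvMinusInv (β -[1+ n ])) (negProd-σ β n) ⟩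
    negProd β n *L zinvMinusInv (β -[1+ n ])
      ∎
    where
    z : LSeries
    z = zinvMinus (β (+ 1))

  shiftedPow-sucˡ : ∀ β k → shiftedPow β (k +ℤ + 1) ≈L zinvMinus (β (+ 1)) *L shiftedPow (σ^ (+ 1) β) k
  shiftedPow-sucˡ β (+ n) rewrite +n+1≡+[1+n] n = positive n
    where
    positive : ∀ n → shiftedPow β (+ suc n) ≈L zinvMinus (β (+ 1)) *L shiftedPow (σ^ (+ 1) β) (+ n)
    positive zero    = *L-comm oneL (zinvMinus (β (+ 1)))
    positive (suc n) = begin
      shiftedPow β (+ suc n) *L zinvMinus (β (+ suc (suc n)))
        ≈⟨ *L-congˡ z′ (positive n) ⟩
      (z *L shiftedPow (σ^ (+ 1) β) (+ n)) *L z′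
        ≈⟨ *L-assoc z (shiftedPow (σ^ (+ 1) β) (+ n)) z′ ⟩
      z *L (shiftedPow (σ^ (+ 1) β) (+ n) *L zinvMinus (β (+ suc (suc n))))
        ≡⟨ ≡.cong (λ i → z *L (shiftedPow (σ^ (+ 1) β) (+ n) *L zinvMinus (β i)))
                  (+n+1≡+[1+n] (suc n)) ⟨
      z *L shiftedPow (σ^ (+ 1) β) (+ suc n)
        ∎
      where
      z z′ : LSeries
      z  = zinvMinus (β (+ 1))
      z′ = zinvMinus (β (+ suc (suc n)))
  shiftedPow-sucˡ β -[1+ zero ]  = ≈L-sym (zinvMinus-inverseʳ (β (+ 1)))
  shiftedPow-sucˡ β -[1+ suc n ] = ≈L-sym (negProd-σ β n)

  shiftedPow-σ⁻¹-suc : ∀ α m →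
    shiftedPow (σ^ -[1+ 0 ] α) (m +ℤ + 1)
      ≈L shiftedPow α (m +ℤ + 1) +L (α (m +ℤ + 1) − α (+ 0)) ·L shiftedPow α m
  shiftedPow-σ⁻¹-suc α m = begin
    shiftedPow (σ^ -[1+ 0 ] α) (m +ℤ + 1)
      ≈⟨ shiftedPow-sucˡ (σ^ -[1+ 0 ] α) m ⟩
    zinvMinus (α (+ 0)) *L shiftedPow (σ^ (+ 1) (σ^ -[1+ 0 ] α)) m
      ≡⟨ ≡.cong (zinvMinus (α (+ 0)) *L_) (shiftedPow-cong (λ i → ≡.cong α ([i+1]-1≡i i)) m) ⟩
    zinvMinus (α (+ 0)) *L shiftedPow α m
      ≈⟨ zinvMinus-*L (α (+ 0)) (α (m +ℤ + 1)) (shiftedPow α m) ⟩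
    zinvMinus (α (m +ℤ + 1)) *L shiftedPow α m +L (α (m +ℤ + 1) − α (+ 0)) ·L shiftedPow α m
      ≈⟨ +L-cong (≈L-trans (*L-comm _ (shiftedPow α m)) (≈L-sym (shiftedPow-sucʳ α m))) ≈L-refl ⟩
    shiftedPow α (m +ℤ + 1) +L (α (m +ℤ + 1) − α (+ 0)) ·L shiftedPow α m
      ∎

  inverse-shiftedPow-σ : ∀ α k (X Y W : LSeries) →
    X *L shiftedPow (σ^ (+ 1) α) k ≈L oneL →
    Y *L shiftedPow α k ≈L oneL →
    W *L shiftedPow α (k +ℤ + 1) ≈L oneL →
    X ≈L Y +L (α (k +ℤ + 1) − α (+ 1)) ·L W
  inverse-shiftedPow-σ α k X Y W XS≈1 YA≈1 WA′≈1 = begin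
    X                    ≈⟨ X≈Wz₁ ⟩
    W *L z₁              ≈⟨ *L-comm W z₁ ⟩
    z₁ *L W              ≈⟨ zinvMinus-*L (α (+ 1)) (α (k +ℤ + 1)) W ⟩
    z′ *L W +L c′ ·L W   ≈⟨ +L-cong (≈L-trans (*L-comm z′ W) (≈L-sym Y≈Wz′)) ≈L-refl ⟩
    Y +L c′ ·L W         ∎
    where
    S A A′ z₁ z′ : LSeries
    S  = shiftedPow (σ^ (+ 1) α) k
    A  = shiftedPow α k
    A′ = shiftedPow α (k +ℤ + 1)
    z₁ = zinvMinus (α (+ 1))
    z′ = zinvMinus (α (k +ℤ + 1))
    c′ : Carrier
    c′ = α (k +ℤ + 1) − α (+ 1)
    inverse-via : ∀ z s → A′ ≈L z *L s → (W *L z) *L s ≈L oneL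
    inverse-via z s A′≈zs = ≈L-trans (*L-assoc W z s) (≈L-trans (*L-congʳ W (≈L-sym A′≈zs)) WA′≈1)
    X≈Wz₁ : X ≈L W *L z₁
    X≈Wz₁ = inverse-unique X (W *L z₁) S XS≈1 (inverse-via z₁ S (shiftedPow-sucˡ α k))
    Y≈Wz′ : Y ≈L W *L z′
    Y≈Wz′ = inverse-unique Y (W *L z′) A YA≈1
              (inverse-via z′ A (≈L-trans (shiftedPow-sucʳ α k) (*L-comm A z′)))

proposition2p4 : ∀ {c ℓ} (R : CommutativeRing c ℓ) → let open CommutativeRing R in let open Laurent R in
    (α : ℤ → Carrier) (k : ℤ) →
      (shiftedPow (σ^ -[1+ 0 ] α) k ≈L shiftedPow α k +L (α k − α (+ 0)) ·L shiftedPow α (k -ℤ + 1))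
      × (∀ (X Y W : LSeries) →
           X *L shiftedPow (σ^ (+ 1) α) k ≈L oneL →
           Y *L shiftedPow α k ≈L oneL →
           W *L shiftedPow α (k +ℤ + 1) ≈L oneL →
           X ≈L Y +L (α (k +ℤ + 1) − α (+ 1)) ·L W)
proposition2p4 R α k =
  ≡.subst first-identity ([i-1]+1≡i k) (shiftedPow-σ⁻¹-suc α (k -ℤ + 1)) , inverse-shiftedPow-σ α k
  where
  open Laurent R
  open ShiftedPowers R
  first-identity : ℤ → Set _
  first-identity j =
    shiftedPow (σ^ -[1+ 0 ] α) j ≈L shiftedPow α j +L (α j − α (+ 0)) ·L shiftedPow α (k -ℤ + 1)
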